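{- Let $G=(V,E)$ be a finite simple undirected graph, $x,y\in V$ distinct, and let $G^{x,y}$ be obtained from $G$ by identifying $x$ and $y$. Then \[\tfrac14\operatorname{nlcw}(G)\le\operatorname{nlcw}(G^{x,y})\le 2\operatorname{nlcw}(G)\quad\text{and}\quad \tfrac14\operatorname{cw}(G)\le\operatorname{cw}(G^{x,y})\le 2\operatorname{cw}(G).\]
   Context: Vertex identification: $G^{x,y}$ has vertex set $(V\setminus\{x,y\})\cup\{z\}$ for a new vertex $z$, and edge set consisting of all edges of $G$ not incident to $x$ or $y$, together with $\{u,z\}$ for every $u\notin\{x,y\}$ such that $\{u,x\}\in E$ or $\{u,y\}\in E$. Clique-width: for a positive integer $k$, $\mathrm{CW}_k$ is the smallest class of graphs whose vertices carry labels from $\{1,\dots,k\}$ that contains every single-vertex graph with any label and is closed under: disjoint union; relabeling $\rho_{a\to b}$ for $a\neq b$; and $\eta_{a,b}$ for $a\neq b$ (add all edges between vertices labeled $a$ and vertices labeled $b$). $\operatorname{cw}(G)$ is the least $k$ such that some labeling of $G$ lies in $\mathrm{CW}_k$. NLC-width: $\mathrm{NLC}_k$ is the smallest class of labeled graphs (labels in $\{1,\dots,k\}$) containing every single-vertex graph with any label and closed under: $G\times_S J$ for $S\subseteq\{1,\dots,k\}^2$ (disjoint union of vertex-disjoint $G$ and $J$ plus all edges $\{u,v\}$, $u\in V_G$, $v\in V_J$, $(\mathrm{lab}(u),\mathrm{lab}(v))\in S$); and $\circ_R$ for $R:\{1,\dots,k\}\to\{1,\dots,k\}$. $\operatorname{nlcw}(G)$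 is the least $k$ such that some labeling of $G$ lies in $\mathrm{NLC}_k$. -}

module Defs where

open import Data.Nat using (ℕ; _≤_)
open import Data.Fin using (Fin; _≟_)
open import Data.Bool using (Bool; T)
open import Data.Empty using (⊥)
open import Data.Unit using (⊤; tt)
open import Data.Sum using (_⊎_; inj₁; inj₂; map)
open import Data.Product using (Σ; Σ-syntax; _×_; _,_; proj₁; proj₂)
open import Relation.Nullary using (¬_; yes; no)
open import Relation.Binary.PropositionalEquality using (_≡_; _≢_; refl)
open import Function.Bundles using (_↔_; _⇔_)

record Graph : Set₁ where
  field
    V      : Set
    E      : V → V → Set
    sym    : ∀ {u v} → E u v → E v u
    irrefl : ∀ {v} → ¬ E v v

open Graph public

Finite : Graph → Set
Finite G = Σ[ n ∈ ℕ ] (V G ↔ Fin n)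

record Iso {A B : Set} (EA : A → A → Set) (EB : B → B → Set) : Set where
  field
    to      : A → B
    from    : B → A
    from∘to : ∀ a → from (to a) ≡ a
    to∘from : ∀ b → to (from b) ≡ b
    edges   : ∀ u v → EA u v ⇔ EB (to u) (to v)

-- Vertex identification G^{x,y}: vertices (V ∖ {x,y}) ∪ {z}, z = inj₂ tt

IdV : (G : Graph) → V G → V G → Set
IdV G x y = (Σ[ v ∈ V G ] (v ≢ x × v ≢ y)) ⊎ ⊤

IdE : (G : Graph) (x y : V G) → IdV G x y → IdV G x y → Set
IdE G x y (inj₁ (u , _)) (inj₁ (v , _)) = E G u v
IdE G x y (inj₁ (u , _)) (inj₂ _)       = E G u x ⊎ E G u y
IdE G x y (inj₂ _)       (inj₁ (v , _)) = E G v x ⊎ E G v y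
IdE G x y (inj₂ _)       (inj₂ _)       = ⊥

IdE-sym : (G : Graph) (x y : V G) → ∀ {u v} → IdE G x y u v → IdE G x y v u
IdE-sym G x y {inj₁ _} {inj₁ _} e = sym G e
IdE-sym G x y {inj₁ _} {inj₂ _} e = e
IdE-sym G x y {inj₂ _} {inj₁ _} e = e
IdE-sym G x y {inj₂ _} {inj₂ _} ()

IdE-irrefl : (G : Graph) (x y : V G) → ∀ {v} → ¬ IdE G x y v v
IdE-irrefl G x y {inj₁ _} e = irrefl G e
IdE-irrefl G x y {inj₂ _} ()

identify : (G : Graph) → V G → V G → Graph
identify G x y = record
  { V = IdV G x y ; E = IdE G x y
  ; sym = λ {u} {v} → IdE-sym G x y {u} {v} ; irrefl = λ {v} → IdE-irrefl G x y {v} }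

data NLC (k : ℕ) : Set where
  •    : Fin k → NLC k
  join : (S : Fin k → Fin k → Bool) → NLC k → NLC k → NLC k
  ∘R   : (R : Fin k → Fin k) → NLC k → NLC k

module _ {k : ℕ} where
  NV : NLC k → Set
  NV (• _)        = ⊤
  NV (join _ a b) = NV a ⊎ NV b
  NV (∘R _ a)     = NV a

  nlab : (e : NLC k) → NV e → Fin k
  nlab (• i)        _        = i
  nlab (join _ a b) (inj₁ u) = nlab a u
  nlab (join _ a b) (inj₂ v) = nlab b v
  nlab (∘R R a)     u        = R (nlab a u)

  NE : (e : NLC k) → NV e → NV e → Set
  NE (• _)        _        _        = ⊥
  NE (join S a b) (inj₁ u) (inj₁ v) = NE a u v
  NE (join S a b) (inj₂ u) (inj₂ v) = NE b u v
  NE (join S a b) (inj₁ u) (inj₂ v) = T (S (nlab a u) (nlab b v))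
  NE (join S a b) (inj₂ v) (inj₁ u) = T (S (nlab a u) (nlab b v))
  NE (∘R _ a)     u        v        = NE a u v

HasNLC : Graph → ℕ → Set
HasNLC G k = Σ[ e ∈ NLC k ] Iso (NE e) (E G)

IsNLCW : Graph → ℕ → Set
IsNLCW G k = HasNLC G k × (∀ j → HasNLC G j → k ≤ j)

data CW (k : ℕ) : Set where
  •   : Fin k → CW k
  _⊕_ : CW k → CW k → CW k
  ρ   : (a b : Fin k) → a ≢ b → CW k → CW k
  η   : (a b : Fin k) → a ≢ b → CW k → CW k

module _ {k : ℕ} where
  CV : CW k → Set
  CV (• _)       = ⊤
  CV (a ⊕ b)     = CV a ⊎ CV b
  CV (ρ _ _ _ a) = CV a
  CV (η _ _ _ a) = CV a

  clab : (e : CW k) → CV e → Fin k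
  clab (• i)       _        = i
  clab (a ⊕ b)     (inj₁ u) = clab a u
  clab (a ⊕ b)     (inj₂ v) = clab b v
  clab (ρ i j _ a) u with clab a u ≟ i
  ... | yes _ = j
  ... | no  _ = clab a u
  clab (η _ _ _ a) u        = clab a u

  CE : (e : CW k) → CV e → CV e → Set
  CE (• _)       _        _        = ⊥
  CE (a ⊕ b)     (inj₁ u) (inj₁ v) = CE a u v
  CE (a ⊕ b)     (inj₂ u) (inj₂ v) = CE b u v
  CE (a ⊕ b)     (inj₁ _) (inj₂ _) = ⊥
  CE (a ⊕ b)     (inj₂ _) (inj₁ _) = ⊥
  CE (ρ _ _ _ a) u        v        = CE a u v
  CE (η i j _ a) u        v        =
    CE a u v ⊎ ((clab a u ≡ i × clab a v ≡ j) ⊎ (clab a u ≡ j × clab a v ≡ i))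

HasCW : Graph → ℕ → Set
HasCW G k = Σ[ e ∈ CW k ] Iso (CE e) (E G)

IsCW : Graph → ℕ → Set
IsCW G k = HasCW G k × (∀ j → HasCW G j → k ≤ j)

-- Let H = G − x − y.  G arises from H by adding y and then x, and G^{x,y} by adding one vertex z
-- with neighbourhood N(x) ∪ N(y).  Neither width grows on induced subgraphs, and adding one vertex
-- at most doubles it: double the label set to flag the future neighbours, then join the new vertex
-- to the flagged labels.  Hence w(G^{x,y}) ≤ 2 w(H) ≤ 2 w(G) and w(G) ≤ 4 w(H) ≤ 4 w(G^{x,y}).
--
-- The vertices of G^{x,y} carry proofs of v ≢ x and v ≢ y, which cannot be identified without
-- function extensionality, so G^{x,y} is only a blow-up of H + z by independent sets of false twins.
-- Width is invariant under such blow-ups: restrict an expression to canonical representatives in one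
-- direction, and in the other substitute for each vertex the part of a given expression lying over it.

{-# OPTIONS --safe #-}
module Submission where

open import Defs hiding (sym; irrefl)
open import Level using (0ℓ)
open import Data.Bool using (Bool; true; false; T; not; _∨_; if_then_else_)
open import Data.Bool.Properties using (T-irrelevant; T-∨; T-≡)
open import Data.Empty using (⊥; ⊥-elim)
open import Data.Fin using (Fin; zero; suc; combine; remQuot)
import Data.Fin as Fin
open import Data.Fin.Properties using (remQuot-combine)
open import Data.List using (List; []; _∷_; allFin)
open import Data.List.Membership.Propositional using (lose)
open import Data.List.Membership.Propositional.Properties using (∈-allFin)
open import Data.List.Relation.Unary.Any as Any using (Any; here; there; satisfied)
open import Data.Nat using (ℕ; zero; suc; _≤_; _*_)
open import Data.Nat.Properties using (≤-trans; ≤-reflexive; *-assoc)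
open import Data.Product using (Σ; Σ-syntax; ∃; _×_; _,_; proj₁; proj₂)
open import Data.Sum as Sum using (_⊎_; inj₁; inj₂; [_,_]; [_,_]′)
open import Data.Sum.Function.Propositional using (_⊎-↔_; _⊎-⇔_)
open import Data.Sum.Properties using () renaming (≡-dec to ⊎-≟)
open import Data.Unit using (⊤; tt)
open import Data.Unit.Properties using () renaming (_≟_ to ⊤-≟)
open import Function using (_∘_; _on_; flip; id; const)
open import Function.Bundles using (_⇔_; mk⇔; Equivalence; _↔_; Inverse; mk↔ₛ′)
open import Function.Construct.Composition using (_⇔-∘_)
open import Function.Construct.Identity using (⇔-id)
open import Function.Construct.Symmetry using (⇔-sym)
open import Function.Properties.Inverse using (↔-refl; ↔-sym; ↔⇒↣)
open import Function.Related.TypeIsomorphisms using (Σ-distribʳ-⊎)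
open import Relation.Binary using (Rel; Decidable; DecidableEquality; Symmetric)
open import Relation.Binary.PropositionalEquality
  using (_≡_; _≢_; refl; sym; trans; cong; cong₂; subst; module ≡-Reasoning)
open import Relation.Nullary using (¬_; Dec; yes; no)
open import Relation.Nullary.Decidable as Dec
  using (T?; _⊎-dec_; _×-dec_; ⌊_⌋; False; toWitness; fromWitness; toWitnessFalse; fromWitnessFalse)
open import Relation.Unary using (Empty)

private variable
  A B C : Set
  k k₀ : ℕ
  R S S′ : Rel A 0ℓ
  Q : Rel C 0ℓ

subtype-≡ : {P : A → Bool} {a a′ : A} {t : T (P a)} {t′ : T (P a′)} →
            a ≡ a′ → _≡_ {A = Σ A (T ∘ P)} (a , t) (a′ , t′)
subtype-≡ {P = P} {a} refl = cong (a ,_) (T-irrelevant _ _)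

⇔-refl : A ⇔ A
⇔-refl = ⇔-id _

⇔-trans : A ⇔ B → B ⇔ C → A ⇔ C
⇔-trans = flip _⇔-∘_

≡⇒⇔ : (P : A → Set) {a a′ : A} → a ≡ a′ → P a ⇔ P a′
≡⇒⇔ P refl = ⇔-refl

≡⇒⇔₂ : (R : A → B → Set) {a a′ : A} {b b′ : B} → a ≡ a′ → b ≡ b′ → R a b ⇔ R a′ b′
≡⇒⇔₂ R refl refl = ⇔-refl

not-both : ∀ {b} → T b → ¬ T (not b)
not-both {true} _ ()

T⌊⌋⇔ : {P : Set} (d : Dec P) → T ⌊ d ⌋ ⇔ P
T⌊⌋⇔ d = mk⇔ toWitness fromWitness

_⊎ᴿ_ : Rel A 0ℓ → Rel B 0ℓ → Rel (A ⊎ B) 0ℓ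
(R ⊎ᴿ S) (inj₁ a) (inj₁ a′) = R a a′
(R ⊎ᴿ S) (inj₂ b) (inj₂ b′) = S b b′
(R ⊎ᴿ S) (inj₁ _) (inj₂ _)  = ⊥
(R ⊎ᴿ S) (inj₂ _) (inj₁ _)  = ⊥

AddVertex : Rel A 0ℓ → (A → Bool) → Rel (A ⊎ ⊤) 0ℓ
AddVertex R N (inj₁ a) (inj₁ a′) = R a a′
AddVertex R N (inj₁ a) (inj₂ _)  = T (N a)
AddVertex R N (inj₂ _) (inj₁ a)  = T (N a)
AddVertex R N (inj₂ _) (inj₂ _)  = ⊥

OnLabels : {L : Set} → (A → L) → L → L → Rel A 0ℓ
OnLabels ℓ i j x y = (ℓ x ≡ i × ℓ y ≡ j) ⊎ (ℓ x ≡ j × ℓ y ≡ i)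

AddVertex-⊎ : ∀ {N : A → Bool} x y → ((R ⊎ᴿ (λ _ _ → ⊥)) x y ⊎ AddVertex (λ _ _ → ⊥) N x y) ⇔ AddVertex R N x y
AddVertex-⊎ (inj₁ _) (inj₁ _) = mk⇔ [ id , ⊥-elim ]′ inj₁
AddVertex-⊎ (inj₁ _) (inj₂ _) = mk⇔ [ ⊥-elim , id ]′ inj₂
AddVertex-⊎ (inj₂ _) (inj₁ _) = mk⇔ [ ⊥-elim , id ]′ inj₂
AddVertex-⊎ (inj₂ _) (inj₂ _) = mk⇔ [ id , id ]′ inj₁

⊥⊎ᴿ⊥ : ∀ (x y : A ⊎ B) → ((λ _ _ → ⊥) ⊎ᴿ (λ _ _ → ⊥)) x y ⇔ ⊥
⊥⊎ᴿ⊥ (inj₁ _) (inj₁ _) = ⇔-refl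
⊥⊎ᴿ⊥ (inj₁ _) (inj₂ _) = ⇔-refl
⊥⊎ᴿ⊥ (inj₂ _) (inj₁ _) = ⇔-refl
⊥⊎ᴿ⊥ (inj₂ _) (inj₂ _) = ⇔-refl

module _ {R : Rel A 0ℓ} {S : Rel B 0ℓ} where

  mkIso : (f : A ↔ B) → (∀ a a′ → R a a′ ⇔ S (Inverse.to f a) (Inverse.to f a′)) → Iso R S
  mkIso f edges = record
    { to = to ; from = from ; from∘to = strictlyInverseʳ ; to∘from = strictlyInverseˡ ; edges = edges }
    where open Inverse f

  Iso⇒↔ : Iso R S → A ↔ B
  Iso⇒↔ I = mk↔ₛ′ to from to∘from from∘to
    where open Iso I

  Iso-sym : Iso R S → Iso S R
  Iso-sym I = record
    { to = from ; from = to ; from∘to = to∘from ; to∘from = from∘to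
    ; edges = λ b b′ → ⇔-sym (⇔-trans (edges (from b) (from b′)) (≡⇒⇔₂ S (to∘from b) (to∘from b′))) }
    where open Iso I

Iso-trans : Iso R S → Iso S Q → Iso R Q
Iso-trans I J = record
  { to = J.to ∘ I.to ; from = I.from ∘ J.from
  ; from∘to = λ a → trans (cong I.from (J.from∘to (I.to a))) (I.from∘to a)
  ; to∘from = λ c → trans (cong J.to (I.to∘from (J.from c))) (J.to∘from c)
  ; edges = λ a a′ → ⇔-trans (I.edges a a′) (J.edges (I.to a) (I.to a′)) }
  where module I = Iso I
        module J = Iso J

Iso-pointwise : {R S : Rel A 0ℓ} → (∀ a a′ → R a a′ ⇔ S a a′) → Iso R S
Iso-pointwise = mkIso ↔-refl

Iso-restrict : (I : Iso R S) (P : B → Bool) →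
               Iso {Σ A (T ∘ P ∘ Iso.to I)} {Σ B (T ∘ P)} (R on proj₁) (S on proj₁)
Iso-restrict {A = A} {B = B} I P = mkIso
  (mk↔ₛ′ (λ (a , t) → to a , t) from′ (λ (b , _) → subtype-≡ (to∘from b)) (λ (a , _) → subtype-≡ (from∘to a)))
  (λ (a , _) (a′ , _) → edges a a′)
  where
  open Iso I
  from′ : Σ B (T ∘ P) → Σ A (T ∘ P ∘ to)
  from′ (b , t) = from b , subst (T ∘ P) (sym (to∘from b)) t

Iso-addVertex : (I : Iso R S) (N : B → Bool) →
                Iso (AddVertex R (N ∘ Iso.to I)) (AddVertex S N)
Iso-addVertex I N = mkIso (Iso⇒↔ I ⊎-↔ ↔-refl) λ
  { (inj₁ a) (inj₁ a′) → Iso.edges I a a′ ; (inj₁ _) (inj₂ _) → ⇔-refl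
  ; (inj₂ _) (inj₁ _)  → ⇔-refl          ; (inj₂ _) (inj₂ _) → ⇔-refl }

is-inj₁ : A ⊎ B → Bool
is-inj₁ = [ const true , const false ]′

Iso-inj₁ : {Q : Rel (A ⊎ B) 0ℓ} →
           Iso {Σ (A ⊎ B) (T ∘ is-inj₁)} (Q on proj₁) (λ a a′ → Q (inj₁ a) (inj₁ a′))
Iso-inj₁ {A} {B} {Q} = mkIso (mk↔ₛ′ to (λ a → inj₁ a , tt) (λ _ → refl) from∘to) edges
  where
  to : Σ (A ⊎ B) (T ∘ is-inj₁) → A
  to (inj₁ a , _) = a
  from∘to : ∀ x → (inj₁ (to x) , tt) ≡ x
  from∘to (inj₁ _ , _) = refl
  edges : ∀ x x′ → (Q on proj₁) x x′ ⇔ Q (inj₁ (to x)) (inj₁ (to x′))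
  edges (inj₁ _ , _) (inj₁ _ , _) = ⇔-refl

Iso-single-vertex : {N : A → Bool} → ¬ A → Iso {⊤} (λ _ _ → ⊥) (AddVertex R N)
Iso-single-vertex none = mkIso
  (mk↔ₛ′ (const (inj₂ tt)) (const tt) (λ { (inj₁ a) → ⊥-elim (none a) ; (inj₂ _) → refl }) (λ _ → refl))
  (λ _ _ → ⇔-refl)

module _ {P : A ⊎ B → Bool} where

  Σ-⊎-inj₁ : Empty (T ∘ P ∘ inj₂) → Σ A (T ∘ P ∘ inj₁) ↔ Σ (A ⊎ B) (T ∘ P)
  Σ-⊎-inj₁ none = mk↔ₛ′ (λ (a , t) → inj₁ a , t) from to∘from (λ _ → refl)
    where
    from : Σ (A ⊎ B) (T ∘ P) → Σ A (T ∘ P ∘ inj₁)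
    from (inj₁ a , t) = a , t
    from (inj₂ b , t) = ⊥-elim (none b t)
    to∘from : ∀ x → (inj₁ (proj₁ (from x)) , proj₂ (from x)) ≡ x
    to∘from (inj₁ _ , _) = refl
    to∘from (inj₂ b , t) = ⊥-elim (none b t)

  Σ-⊎-inj₂ : Empty (T ∘ P ∘ inj₁) → Σ B (T ∘ P ∘ inj₂) ↔ Σ (A ⊎ B) (T ∘ P)
  Σ-⊎-inj₂ none = mk↔ₛ′ (λ (b , t) → inj₂ b , t) from to∘from (λ _ → refl)
    where
    from : Σ (A ⊎ B) (T ∘ P) → Σ B (T ∘ P ∘ inj₂)
    from (inj₁ a , t) = ⊥-elim (none a t)
    from (inj₂ b , t) = b , t
    to∘from : ∀ x → (inj₂ (proj₁ (from x)) , proj₂ (from x)) ≡ x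
    to∘from (inj₁ a , t) = ⊥-elim (none a t)
    to∘from (inj₂ _ , _) = refl

⊤↔Σ : {P : ⊤ → Bool} → T (P tt) → ⊤ ↔ Σ ⊤ (T ∘ P)
⊤↔Σ t = mk↔ₛ′ (const (tt , t)) (const tt) (λ _ → subtype-≡ refl) (λ _ → refl)

⊤-Σ-↔ : {F : ⊤ → Set} → F tt ↔ Σ ⊤ F
⊤-Σ-↔ = mk↔ₛ′ (tt ,_) proj₂ (λ _ → refl) (λ _ → refl)

Σ-⊎-↔ : {F : A ⊎ B → Set} → (Σ A (F ∘ inj₁) ⊎ Σ B (F ∘ inj₂)) ↔ Σ (A ⊎ B) F
Σ-⊎-↔ = ↔-sym Σ-distribʳ-⊎

Choose : (A → Bool) → (⊤ ⊎ A) ⊎ A → Bool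
Choose N (inj₁ (inj₁ _)) = true
Choose N (inj₁ (inj₂ a)) = N a
Choose N (inj₂ a)        = not (N a)

choose-↔ : (N : A → Bool) → Σ ((⊤ ⊎ A) ⊎ A) (T ∘ Choose N) ↔ (A ⊎ ⊤)
choose-↔ {A} N = mk↔ₛ′ to from to∘from from∘to
  where
  to : Σ ((⊤ ⊎ A) ⊎ A) (T ∘ Choose N) → A ⊎ ⊤
  to (inj₁ (inj₁ _) , _) = inj₂ tt
  to (inj₁ (inj₂ a) , _) = inj₁ a
  to (inj₂ a        , _) = inj₁ a
  from′ : (a : A) (b : Bool) → N a ≡ b → Σ ((⊤ ⊎ A) ⊎ A) (T ∘ Choose N)
  from′ a true  eq = inj₁ (inj₂ a) , subst T (sym eq) tt
  from′ a false eq = inj₂ a , subst (T ∘ not) (sym eq) tt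
  from : A ⊎ ⊤ → Σ ((⊤ ⊎ A) ⊎ A) (T ∘ Choose N)
  from (inj₁ a) = from′ a (N a) refl
  from (inj₂ _) = inj₁ (inj₁ tt) , tt
  to∘from : ∀ x → to (from x) ≡ x
  to∘from (inj₁ a) = go (N a) refl
    where
    go : ∀ b (eq : N a ≡ b) → to (from′ a b eq) ≡ inj₁ a
    go true  _ = refl
    go false _ = refl
  to∘from (inj₂ _) = refl
  from∘to : ∀ p → from (to p) ≡ p
  from∘to (inj₁ (inj₁ _) , _) = refl
  from∘to (inj₁ (inj₂ a) , t) = go (N a) refl
    where
    go : ∀ b (eq : N a ≡ b) → from′ a b eq ≡ (inj₁ (inj₂ a) , t)
    go true  _  = subtype-≡ {P = Choose N} refl
    go false eq = ⊥-elim (subst T eq t)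
  from∘to (inj₂ a , t) = go (N a) refl
    where
    go : ∀ b (eq : N a ≡ b) → from′ a b eq ≡ (inj₂ a , t)
    go true  eq = ⊥-elim (subst (T ∘ not) eq t)
    go false _  = subtype-≡ {P = Choose N} refl

Any-allFin⇔∃ : ∀ {n} {P : Fin n → Set} → Any P (allFin n) ⇔ ∃ P
Any-allFin⇔∃ = mk⇔ satisfied (λ (i , p) → lose (∈-allFin i) p)

module _ {U W : Set} (φ : W → U) (_≟_ : DecidableEquality U) where

  Fibre : U → Set
  Fibre u = Σ W (λ w → T ⌊ φ w ≟ u ⌋)

  Σ-fibres : {F : U → Set} → (∀ u → F u ↔ Fibre u) → Σ U F ↔ W
  Σ-fibres {F} f = mk↔ₛ′ to from (λ w → cong proj₁ (strictlyInverseˡ (f (φ w)) _)) from∘to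
    where
    open Inverse using (strictlyInverseˡ; strictlyInverseʳ)
    to : Σ U F → W
    to (u , s) = proj₁ (Inverse.to (f u) s)
    from : W → Σ U F
    from w = φ w , Inverse.from (f (φ w)) (w , fromWitness refl)
    from∘to : ∀ p → from (to p) ≡ p
    from∘to (u , s) with Inverse.to (f u) s in eq
    ... | w , t with toWitness t
    ... | refl = cong (φ w ,_) (begin
      Inverse.from (f (φ w)) (w , _) ≡⟨ cong (Inverse.from (f (φ w))) (subtype-≡ refl) ⟩
      Inverse.from (f (φ w)) (w , t) ≡⟨ cong (Inverse.from (f (φ w))) eq ⟨
      Inverse.from (f (φ w)) (Inverse.to (f (φ w)) s) ≡⟨ strictlyInverseʳ (f (φ w)) s ⟩
      s ∎)
      where open ≡-Reasoning

  Σ-fibres-φ : {F : U → Set} (f : ∀ u → F u ↔ Fibre u) (p : Σ U F) → φ (Inverse.to (Σ-fibres f) p) ≡ proj₁ p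
  Σ-fibres-φ f (u , s) = toWitness (proj₂ (Inverse.to (f u) s))

module _ {U W : Set} (ψ : W → U) (rep : U → W) (ψ-rep : ∀ u → ψ (rep u) ≡ u) (_≟_ : DecidableEquality W) where

  Canonical : W → Bool
  Canonical w = ⌊ w ≟ rep (ψ w) ⌋

  Σ-canonical : Σ W (T ∘ Canonical) ↔ U
  Σ-canonical = mk↔ₛ′ (ψ ∘ proj₁) (λ u → rep u , fromWitness (cong rep (sym (ψ-rep u)))) ψ-rep
                      (λ (w , t) → subtype-≡ (sym (toWitness t)))

-- A record rather than a Σ-type, so that _≟_ and w can be inferred from its type.
record Others (_≟_ : DecidableEquality A) (w : A) : Set where
  constructor _,_
  field
    elem  : A
    elem≢ : False (elem ≟ w)

open Others using (elem)

Others-≡ : {_≟_ : DecidableEquality A} {w : A} {o o′ : Others _≟_ w} → elem o ≡ elem o′ → o ≡ o′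
Others-≡ {o = a , t} {.a , t′} refl = cong (a ,_) (T-irrelevant t t′)

≟-Others : {_≟_ : DecidableEquality A} {w : A} → DecidableEquality (Others _≟_ w)
≟-Others {_≟_ = _≟_} o o′ = Dec.map′ Others-≡ (cong elem) (elem o ≟ elem o′)

module _ {R : Rel A 0ℓ} (R-sym : Symmetric R) (R-irrefl : ∀ {a} → ¬ R a a)
         (_≟_ : DecidableEquality A) (R? : Decidable R) (w : A) where

  remove-vertex : Iso (AddVertex (R on elem) (λ o → ⌊ R? (elem o) w ⌋)) R
  remove-vertex = mkIso (mk↔ₛ′ to from to∘from from∘to) edges
    where
    to : Others _≟_ w ⊎ ⊤ → A
    to (inj₁ (a , _)) = a
    to (inj₂ _)       = w
    from′ : (a : A) → Dec (a ≡ w) → Others _≟_ w ⊎ ⊤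
    from′ a (yes _)   = inj₂ tt
    from′ a (no  a≢w) = inj₁ (a , fromWitnessFalse a≢w)
    from : A → Others _≟_ w ⊎ ⊤
    from a = from′ a (a ≟ w)
    to∘from : ∀ a → to (from a) ≡ a
    to∘from a = go (a ≟ w)
      where
      go : (d : Dec (a ≡ w)) → to (from′ a d) ≡ a
      go (yes a≡w) = sym a≡w
      go (no  _)   = refl
    from∘to : ∀ o → from (to o) ≡ o
    from∘to (inj₁ (a , a≢w)) = go (a ≟ w)
      where
      go : (d : Dec (a ≡ w)) → from′ a d ≡ inj₁ (a , a≢w)
      go (yes a≡w) = ⊥-elim (toWitnessFalse a≢w a≡w)
      go (no  _)   = cong inj₁ (Others-≡ refl)
    from∘to (inj₂ _) = go (w ≟ w)
      where
      go : (d : Dec (w ≡ w)) → from′ w d ≡ inj₂ tt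
      go (yes _)   = refl
      go (no  w≢w) = ⊥-elim (w≢w refl)
    edges : ∀ o o′ → AddVertex (R on elem) (λ o → ⌊ R? (elem o) w ⌋) o o′ ⇔ R (to o) (to o′)
    edges (inj₁ _)       (inj₁ _)       = ⇔-refl
    edges (inj₁ (a , _)) (inj₂ _)       = T⌊⌋⇔ (R? a w)
    edges (inj₂ _)       (inj₁ (a , _)) = ⇔-trans (T⌊⌋⇔ (R? a w)) (mk⇔ R-sym R-sym)
    edges (inj₂ _)       (inj₂ _)       = mk⇔ ⊥-elim R-irrefl

-- Widths defined by labelled expressions

record Expressions : Set₁ where
  field
    Expr : ℕ → Set
    Vtx  : ∀ {k} → Expr k → Set
    Adj  : ∀ {k} (e : Expr k) → Rel (Vtx e) 0ℓ
    lab  : ∀ {k} (e : Expr k) → Vtx e → Fin k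

  Expressible : ℕ → Rel A 0ℓ → Set
  Expressible k R = Σ[ e ∈ Expr k ] Iso (Adj e) R

  IsWidth : Rel A 0ℓ → ℕ → Set
  IsWidth R k = Expressible k R × (∀ j → Expressible j R → k ≤ j)

  record Represents {k} (e : Expr k) {A : Set} (R : Rel A 0ℓ) (ℓ : A → Fin k) : Set where
    constructor represents
    pattern
    field
      iso    : Iso (Adj e) R
      labels : ∀ u → lab e u ≡ ℓ (Iso.to iso u)

  along : ∀ {e : Expr k} {ℓ ℓ′} →
          Represents e R ℓ → (J : Iso R S) → (∀ a → ℓ a ≡ ℓ′ (Iso.to J a)) → Represents e S ℓ′
  along (represents I L) J M = represents (Iso-trans I J) (λ u → trans (L u) (M (Iso.to I u)))

  relabelled : ∀ {e : Expr k} {ℓ ℓ′} → Represents e R ℓ → (∀ a → ℓ a ≡ ℓ′ a) → Represents e R ℓ′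
  relabelled r = along r (Iso-pointwise (λ _ _ → ⇔-refl))

record WidthAxioms (X : Expressions) : Set₁ where
  open Expressions X
  field
    no-expr₀   : Expr 0 → ⊥
    vertex     : ∀ {k} (e : Expr k) → Vtx e
    point      : ∀ {k} → Fin k → Expressible {A = ⊤} k (λ _ _ → ⊥)
    vertex-≟   : ∀ {k} (e : Expr k) → DecidableEquality (Vtx e)
    adjacent?  : ∀ {k} (e : Expr k) → Decidable (Adj e)
    restrict   : ∀ {k} (e : Expr k) (P : Vtx e → Bool) →
                 Empty (T ∘ P) ⊎ Expressible {A = Σ (Vtx e) (T ∘ P)} k (Adj e on proj₁)
    substitute : ∀ {k k₀} (e : Expr k) (σ : Vtx e → Expr k₀) →
                 Expressible {A = Σ (Vtx e) (Vtx ∘ σ)} k (Adj e on proj₁)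
    add-vertex : ∀ {k} (e : Expr k) (N : Vtx e → Bool) → Expressible (2 * k) (AddVertex (Adj e) N)

record BlowUp (R : Rel A 0ℓ) (S : Rel B 0ℓ) : Set where
  field
    π         : B → A
    section   : A → B
    π-section : ∀ a → π (section a) ≡ a
    edges     : ∀ b b′ → S b b′ ⇔ R (π b) (π b′)

module Width {X : Expressions} (W : WidthAxioms X) where
  open Expressions X
  open WidthAxioms W

  transport : Iso R S → Expressible k R → Expressible k S
  transport J (e , I) = e , Iso-trans I J

  adjacent?-of : Expressible k R → Decidable R
  adjacent?-of {R = R} (e , I) a a′ =
    Dec.map (⇔-trans (edges (from a) (from a′)) (≡⇒⇔₂ R (to∘from a) (to∘from a′))) (adjacent? e (from a) (from a′))
    where open Iso I

  restrict-expressible : {R : Rel A 0ℓ} → Expressible k R → (P : A → Bool) →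
                         Empty (T ∘ P) ⊎ Expressible {A = Σ A (T ∘ P)} k (R on proj₁)
  restrict-expressible (e , I) P =
    Sum.map (λ none a t → none (from a) (subst (T ∘ P) (sym (to∘from a)) t))
            (transport (Iso-restrict I P))
            (restrict e (P ∘ to))
    where open Iso I

  delete-vertex : {R : Rel A 0ℓ} {N : A → Bool} → Expressible k (AddVertex R N) → ¬ A ⊎ Expressible k R
  delete-vertex h = Sum.map (λ none a → none (inj₁ a) tt) (transport Iso-inj₁) (restrict-expressible h is-inj₁)

  extend : {R : Rel A 0ℓ} → ¬ A ⊎ Expressible (suc k) R → (N : A → Bool) →
           Expressible (2 * suc k) (AddVertex R N)
  extend (inj₁ none)    N = transport (Iso-single-vertex none) (point zero)
  extend (inj₂ (e , I)) N = transport (Iso-addVertex I N) (add-vertex e (N ∘ Iso.to I))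

  shrink : {R : Rel A 0ℓ} {S : Rel B 0ℓ} → BlowUp R S → Expressible k S → Expressible k R
  shrink {A = A} {R = R} {S = S} β (e₀ , I₀) =
    [ (λ none → ⊥-elim (none _ (proj₂ (Inverse.from canonical (β.π (I₀.to (vertex e₀))))))) ,
      transport (mkIso canonical edges) ]′
    (restrict e₀ (Canonical ψ rep ψ-rep (vertex-≟ e₀)))
    where
    module β = BlowUp β
    module I₀ = Iso I₀
    ψ : Vtx e₀ → A
    ψ = β.π ∘ I₀.to
    rep : A → Vtx e₀
    rep = I₀.from ∘ β.section
    ψ-rep : ∀ a → ψ (rep a) ≡ a
    ψ-rep a = trans (cong β.π (I₀.to∘from (β.section a))) (β.π-section a)
    canonical : Σ (Vtx e₀) (T ∘ Canonical ψ rep ψ-rep (vertex-≟ e₀)) ↔ A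
    canonical = Σ-canonical ψ rep ψ-rep (vertex-≟ e₀)
    edges : ∀ w w′ → (Adj e₀ on proj₁) w w′ ⇔ R (ψ (proj₁ w)) (ψ (proj₁ w′))
    edges (w , _) (w′ , _) = ⇔-trans (I₀.edges w w′) (β.edges (I₀.to w) (I₀.to w′))

  grow : BlowUp R S → Expressible k₀ S → Expressible k R → Expressible k S
  grow {R = R} {S = S} {k₀ = k₀} β (e₀ , I₀) (e , I) =
    transport (Iso-trans (mkIso fibres regroup) (mkIso (Iso⇒↔ I₀) edges)) (substitute e (proj₁ ∘ fibre))
    where
    module β = BlowUp β
    module I₀ = Iso I₀
    module I = Iso I
    φ : Vtx e₀ → Vtx e
    φ = I.from ∘ β.π ∘ I₀.to
    φ-section : ∀ u → φ (I₀.from (β.section (I.to u))) ≡ u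
    φ-section u = trans (cong I.from (trans (cong β.π (I₀.to∘from _)) (β.π-section _))) (I.from∘to u)
    fibre : (u : Vtx e) → Expressible {A = Fibre φ (vertex-≟ e) u} k₀ (Adj e₀ on proj₁)
    fibre u = [ (λ none → ⊥-elim (none _ (fromWitness (φ-section u)))) , id ]′
              (restrict e₀ (λ w → ⌊ vertex-≟ e (φ w) u ⌋))
    fibres : Σ (Vtx e) (Vtx ∘ proj₁ ∘ fibre) ↔ Vtx e₀
    fibres = Σ-fibres φ (vertex-≟ e) (Iso⇒↔ ∘ proj₂ ∘ fibre)
    regroup : ∀ p p′ → (Adj e on proj₁) p p′ ⇔ (Adj e on φ) (Inverse.to fibres p) (Inverse.to fibres p′)
    regroup p p′ = ≡⇒⇔₂ (Adj e) (sym (fibres-φ p)) (sym (fibres-φ p′))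
      where
      fibres-φ : ∀ p → φ (Inverse.to fibres p) ≡ proj₁ p
      fibres-φ = Σ-fibres-φ φ (vertex-≟ e) (Iso⇒↔ ∘ proj₂ ∘ fibre)
    edges : ∀ w w′ → (Adj e on φ) w w′ ⇔ S (I₀.to w) (I₀.to w′)
    edges w w′ = ⇔-trans (I.edges (φ w) (φ w′))
                 (⇔-trans (≡⇒⇔₂ R (I.to∘from _) (I.to∘from _)) (⇔-sym (β.edges (I₀.to w) (I₀.to w′))))

-- Identifying two vertices

module Identification (G : Graph) (x y : V G) (x≢y : x ≢ y)
                      (_≟_ : DecidableEquality (V G)) (adjacent? : Decidable (E G)) where

  y′ : Others _≟_ x
  y′ = y , fromWitnessFalse (x≢y ∘ sym)

  H : Set
  H = Others ≟-Others y′

  EH : Rel H 0ℓ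
  EH = (E G on elem) on elem

  Nx : Others _≟_ x → Bool
  Nx o = ⌊ adjacent? (elem o) x ⌋

  Ny Nz : H → Bool
  Ny h = ⌊ adjacent? (elem (elem h)) y ⌋
  Nz h = ⌊ adjacent? (elem (elem h)) x ⌋ ∨ ⌊ adjacent? (elem (elem h)) y ⌋

  remove-x : Iso (AddVertex (E G on elem) Nx) (E G)
  remove-x = remove-vertex (Graph.sym G) (Graph.irrefl G) _≟_ adjacent? x

  remove-y : Iso (AddVertex EH Ny) (E G on elem)
  remove-y = remove-vertex (Graph.sym G) (Graph.irrefl G) ≟-Others (λ a a′ → adjacent? (elem a) (elem a′)) y′

  G≅H+y+x : Iso (AddVertex (AddVertex EH Ny) (Nx ∘ Iso.to remove-y)) (E G)
  G≅H+y+x = Iso-trans (Iso-addVertex remove-y Nx) remove-x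

  blow-up : BlowUp (AddVertex EH Nz) (IdE G x y)
  blow-up = record { π = π ; section = section ; π-section = π-section ; edges = edges }
    where
    π : IdV G x y → H ⊎ ⊤
    π (inj₁ (v , v≢x , v≢y)) = inj₁ ((v , fromWitnessFalse v≢x) , fromWitnessFalse (v≢y ∘ cong elem))
    π (inj₂ _)               = inj₂ tt
    section : H ⊎ ⊤ → IdV G x y
    section (inj₁ ((v , t) , t′)) = inj₁ (v , toWitnessFalse t , toWitnessFalse t′ ∘ Others-≡)
    section (inj₂ _)              = inj₂ tt
    π-section : ∀ h → π (section h) ≡ h
    π-section (inj₁ _) = cong inj₁ (Others-≡ (Others-≡ refl))
    π-section (inj₂ _) = refl
    z-edge : ∀ v → (E G v x ⊎ E G v y) ⇔ T (⌊ adjacent? v x ⌋ ∨ ⌊ adjacent? v y ⌋)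
    z-edge v = ⇔-sym (⇔-trans T-∨ (T⌊⌋⇔ (adjacent? v x) ⊎-⇔ T⌊⌋⇔ (adjacent? v y)))
    edges : ∀ v v′ → IdE G x y v v′ ⇔ AddVertex EH Nz (π v) (π v′)
    edges (inj₁ _)       (inj₁ _)       = ⇔-refl
    edges (inj₁ (v , _)) (inj₂ _)       = z-edge v
    edges (inj₂ _)       (inj₁ (v , _)) = z-edge v
    edges (inj₂ _)       (inj₂ _)       = ⇔-refl

module _ {X : Expressions} (W : WidthAxioms X) (G : Graph) (x y : V G) (x≢y : x ≢ y)
         (_≟_ : DecidableEquality (V G)) where
  open Expressions X
  open WidthAxioms W
  open Width W

  module _ (adjacent? : Decidable (E G)) where
    open Identification G x y x≢y _≟_ adjacent?

    expressible-identified : ∀ {a b₀} → Expressible a (E G) → Expressible b₀ (IdE G x y) →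
                             Expressible (2 * a) (IdE G x y)
    expressible-identified {zero}  (e , _) _ = ⊥-elim (no-expr₀ e)
    expressible-identified {suc a} hG h₀     = grow blow-up h₀ (extend (delete-vertex H+y) Nz)
      where
      H+y : Expressible (suc a) (AddVertex EH Ny)
      H+y = [ (λ none → ⊥-elim (none (inj₂ tt))) , id ]′ (delete-vertex (transport (Iso-sym G≅H+y+x) hG))

    expressible-original : ∀ {b} → Expressible b (IdE G x y) → Expressible (2 * (2 * b)) (E G)
    expressible-original {zero}  (e , _) = ⊥-elim (no-expr₀ e)
    expressible-original {suc b} h       =
      transport G≅H+y+x (extend (inj₂ (extend (delete-vertex (shrink blow-up h)) Ny)) (Nx ∘ Iso.to remove-y))

  width-bounds : ∀ a b → IsWidth (E G) a → IsWidth (IdE G x y) b → a ≤ 4 * b × b ≤ 2 * a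
  width-bounds a b (hG , min-G) (hI , min-I) =
      ≤-trans (min-G _ (expressible-original adjacent hI)) (≤-reflexive (sym (*-assoc 2 2 b)))
    , min-I _ (expressible-identified adjacent hG hI)
    where
    adjacent : Decidable (E G)
    adjacent = adjacent?-of hG

bit : Bool → Fin 2
bit false = zero
bit true  = suc zero

unbit : Fin 2 → Bool
unbit zero    = false
unbit (suc _) = true

unbit-bit : ∀ b → unbit (bit b) ≡ b
unbit-bit false = refl
unbit-bit true  = refl

module _ {k : ℕ} where

  -- Opaque, so that flagged i b stays rigid in unification and implicit arguments can be inferred.
  opaque
    flagged : Fin k → Bool → Fin (2 * k)
    flagged i b = combine (bit b) i

    base : Fin (2 * k) → Fin k
    base c = proj₂ (remQuot {2} k c)

    flag : Fin (2 * k) → Bool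
    flag c = unbit (proj₁ (remQuot {2} k c))

    base-flagged : ∀ i b → base (flagged i b) ≡ i
    base-flagged i b = cong proj₂ (remQuot-combine (bit b) i)

    flag-flagged : ∀ i b → flag (flagged i b) ≡ b
    flag-flagged i b = trans (cong (unbit ∘ proj₁) (remQuot-combine (bit b) i)) (unbit-bit b)

  flagged-injectiveˡ : ∀ {i j b b′} → flagged i b ≡ flagged j b′ → i ≡ j
  flagged-injectiveˡ {i} {j} {b} {b′} eq = trans (sym (base-flagged i b)) (trans (cong base eq) (base-flagged j b′))

  flagged-injectiveʳ : ∀ {i j b b′} → flagged i b ≡ flagged j b′ → b ≡ b′
  flagged-injectiveʳ {i} {j} {b} {b′} eq = trans (sym (flag-flagged i b)) (trans (cong flag eq) (flag-flagged j b′))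

  flagged-≢ˡ : ∀ {i j : Fin k} b b′ → i ≢ j → flagged i b ≢ flagged j b′
  flagged-≢ˡ b b′ i≢j = i≢j ∘ flagged-injectiveˡ

  flagged-≢ʳ : ∀ (i j : Fin k) b → flagged i b ≢ flagged j (not b)
  flagged-≢ʳ i j false = (λ ()) ∘ flagged-injectiveʳ
  flagged-≢ʳ i j true  = (λ ()) ∘ flagged-injectiveʳ

-- Clique-width

cw-expressions : Expressions
cw-expressions = record { Expr = CW ; Vtx = CV ; Adj = CE ; lab = clab }

module CliqueWidth where
  open Expressions cw-expressions using (Expressible; Represents; represents; along; relabelled; module Represents)

  relabel : Fin k → Fin k → Fin k → Fin k
  relabel i j c = if ⌊ c Fin.≟ i ⌋ then j else c

  clab-ρ : ∀ (i j : Fin k) p a u → clab (ρ i j p a) u ≡ relabel i j (clab a u)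
  clab-ρ i j p a u with clab a u Fin.≟ i
  ... | yes _ = refl
  ... | no  _ = refl

  relabel-≡ : ∀ (i j : Fin k) → relabel i j i ≡ j
  relabel-≡ i j with i Fin.≟ i
  ... | yes _  = refl
  ... | no i≢i = ⊥-elim (i≢i refl)

  relabel-≢ : ∀ (i j c : Fin k) → c ≢ i → relabel i j c ≡ c
  relabel-≢ i j c c≢i with c Fin.≟ i
  ... | yes c≡i = ⊥-elim (c≢i c≡i)
  ... | no  _   = refl

  relabel-≢-source : ∀ {i j : Fin k} c → j ≢ i → relabel i j c ≢ i
  relabel-≢-source {i = i} c j≢i with c Fin.≟ i
  ... | yes _   = j≢i
  ... | no  c≢i = c≢i

  flag-relabel : ∀ {i j : Fin (2 * k)} c → flag {k} i ≡ flag j → flag {k} (relabel i j c) ≡ flag c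
  flag-relabel {i = i} c same with c Fin.≟ i
  ... | yes refl = sym same
  ... | no  _    = refl

  CE-⊕ : ∀ (a b : CW k) x y → (CE a ⊎ᴿ CE b) x y ⇔ CE (a ⊕ b) x y
  CE-⊕ a b (inj₁ _) (inj₁ _) = ⇔-refl
  CE-⊕ a b (inj₁ _) (inj₂ _) = ⇔-refl
  CE-⊕ a b (inj₂ _) (inj₁ _) = ⇔-refl
  CE-⊕ a b (inj₂ _) (inj₂ _) = ⇔-refl

  rep-• : (i : Fin k) → Represents (• i) {A = ⊤} (λ _ _ → ⊥) (const i)
  rep-• i = represents (Iso-pointwise (λ _ _ → ⇔-refl)) (λ _ → refl)

  rep-⊕ : ∀ {a b : CW k} {ℓ ℓ′} → Represents a R ℓ → Represents b S ℓ′ → Represents (a ⊕ b) (R ⊎ᴿ S) [ ℓ , ℓ′ ]′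
  rep-⊕ {R = R} {S = S} {a = a} {b = b} (represents I L) (represents J M) =
    represents (mkIso (Iso⇒↔ I ⊎-↔ Iso⇒↔ J) edges) [ L , M ]
    where
    edges : ∀ x y → CE (a ⊕ b) x y ⇔ (R ⊎ᴿ S) (Sum.map (Iso.to I) (Iso.to J) x) (Sum.map (Iso.to I) (Iso.to J) y)
    edges (inj₁ u) (inj₁ v) = Iso.edges I u v
    edges (inj₁ _) (inj₂ _) = ⇔-refl
    edges (inj₂ _) (inj₁ _) = ⇔-refl
    edges (inj₂ u) (inj₂ v) = Iso.edges J u v

  rep-ρ : ∀ {a : CW k} {ℓ} i j p → Represents a R ℓ → Represents (ρ i j p a) R (relabel i j ∘ ℓ)
  rep-ρ {a = a} i j p (represents I L) = represents I (λ u → trans (clab-ρ i j p a u) (cong (relabel i j) (L u)))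

  rep-η : ∀ {a : CW k} {ℓ} i j p → Represents a R ℓ →
          Represents (η i j p a) (λ x y → R x y ⊎ OnLabels ℓ i j x y) ℓ
  rep-η i j p (represents I L) =
    represents (mkIso (Iso⇒↔ I) (λ u v → Iso.edges I u v ⊎-⇔ ≡⇒⇔₂ (OnLabels id i j) (L u) (L v))) L

  flat : Fin k → CW k₀ → CW k
  flat i (• _)       = • i
  flat i (a ⊕ b)     = flat i a ⊕ flat i b
  flat i (ρ _ _ _ a) = flat i a
  flat i (η _ _ _ a) = flat i a

  rep-flat : (i : Fin k) (f : CW k₀) → Represents (flat i f) {A = CV f} (λ _ _ → ⊥) (const i)
  rep-flat i (• _)       = rep-• i
  rep-flat i (a ⊕ b)     =
    along (rep-⊕ (rep-flat i a) (rep-flat i b)) (Iso-pointwise ⊥⊎ᴿ⊥) [ (λ _ → refl) , (λ _ → refl) ]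
  rep-flat i (ρ _ _ _ a) = rep-flat i a
  rep-flat i (η _ _ _ a) = rep-flat i a

  CE-⊕-Σ : ∀ (a b : CW k) {F : CV a ⊎ CV b → Set} x y →
           ((CE a on proj₁) ⊎ᴿ (CE b on proj₁)) x y ⇔
           (CE (a ⊕ b) on proj₁) (Inverse.to (Σ-⊎-↔ {F = F}) x) (Inverse.to Σ-⊎-↔ y)
  CE-⊕-Σ a b (inj₁ _) (inj₁ _) = ⇔-refl
  CE-⊕-Σ a b (inj₁ _) (inj₂ _) = ⇔-refl
  CE-⊕-Σ a b (inj₂ _) (inj₁ _) = ⇔-refl
  CE-⊕-Σ a b (inj₂ _) (inj₂ _) = ⇔-refl

  restrict : (e : CW k) (P : CV e → Bool) →
             Empty (T ∘ P) ⊎ Σ[ e′ ∈ CW k ] Represents e′ {A = Σ (CV e) (T ∘ P)} (CE e on proj₁) (clab e ∘ proj₁)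
  restrict (• i) P with T? (P tt)
  ... | yes t  = inj₂ (• i , along (rep-• i) (mkIso (⊤↔Σ t) (λ _ _ → ⇔-refl)) (λ _ → refl))
  ... | no  ¬t = inj₁ (λ _ → ¬t)
  restrict (a ⊕ b) P with restrict a (P ∘ inj₁) | restrict b (P ∘ inj₂)
  ... | inj₁ none₁     | inj₁ none₂     = inj₁ [ none₁ , none₂ ]
  ... | inj₂ (a′ , ra) | inj₁ none₂     = inj₂ (a′ , along ra (mkIso (Σ-⊎-inj₁ none₂) (λ _ _ → ⇔-refl)) (λ _ → refl))
  ... | inj₁ none₁     | inj₂ (b′ , rb) = inj₂ (b′ , along rb (mkIso (Σ-⊎-inj₂ none₁) (λ _ _ → ⇔-refl)) (λ _ → refl))
  ... | inj₂ (a′ , ra) | inj₂ (b′ , rb) =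
    inj₂ (a′ ⊕ b′ , along (rep-⊕ ra rb) (mkIso Σ-⊎-↔ (CE-⊕-Σ a b)) [ (λ _ → refl) , (λ _ → refl) ])
  restrict (ρ i j p a) P =
    Sum.map₂ (λ (a′ , ra) → ρ i j p a′ , relabelled (rep-ρ i j p ra) (sym ∘ clab-ρ i j p a ∘ proj₁)) (restrict a P)
  restrict (η i j p a) P = Sum.map₂ (λ (a′ , ra) → η i j p a′ , rep-η i j p ra) (restrict a P)

  substitute : (e : CW k) → (CV e → CW k₀) → CW k
  substitute (• i)       σ = flat i (σ tt)
  substitute (a ⊕ b)     σ = substitute a (σ ∘ inj₁) ⊕ substitute b (σ ∘ inj₂)
  substitute (ρ i j p a) σ = ρ i j p (substitute a σ)
  substitute (η i j p a) σ = η i j p (substitute a σ)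

  rep-substitute : (e : CW k) (σ : CV e → CW k₀) →
                   Represents (substitute e σ) {A = Σ (CV e) (CV ∘ σ)} (CE e on proj₁) (clab e ∘ proj₁)
  rep-substitute (• i)       σ = along (rep-flat i (σ tt)) (mkIso ⊤-Σ-↔ (λ _ _ → ⇔-refl)) (λ _ → refl)
  rep-substitute (a ⊕ b)     σ =
    along (rep-⊕ (rep-substitute a (σ ∘ inj₁)) (rep-substitute b (σ ∘ inj₂))) (mkIso Σ-⊎-↔ (CE-⊕-Σ a b))
          [ (λ _ → refl) , (λ _ → refl) ]
  rep-substitute (ρ i j p a) σ = relabelled (rep-ρ i j p (rep-substitute a σ)) (sym ∘ clab-ρ i j p a ∘ proj₁)
  rep-substitute (η i j p a) σ = rep-η i j p (rep-substitute a σ)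

  no-expr₀ : CW 0 → ⊥
  no-expr₀ (• ())
  no-expr₀ (a ⊕ _)       = no-expr₀ a
  no-expr₀ (ρ () _ _ _)
  no-expr₀ (η () _ _ _)

  vertex : (e : CW k) → CV e
  vertex (• _)       = tt
  vertex (a ⊕ _)     = inj₁ (vertex a)
  vertex (ρ _ _ _ a) = vertex a
  vertex (η _ _ _ a) = vertex a

  vertex-≟ : (e : CW k) → DecidableEquality (CV e)
  vertex-≟ (• _)       = ⊤-≟
  vertex-≟ (a ⊕ b)     = ⊎-≟ (vertex-≟ a) (vertex-≟ b)
  vertex-≟ (ρ _ _ _ a) = vertex-≟ a
  vertex-≟ (η _ _ _ a) = vertex-≟ a

  adjacent? : (e : CW k) → Decidable (CE e)
  adjacent? (• _)       _        _        = no λ ()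
  adjacent? (a ⊕ b)     (inj₁ u) (inj₁ v) = adjacent? a u v
  adjacent? (a ⊕ b)     (inj₁ _) (inj₂ _) = no λ ()
  adjacent? (a ⊕ b)     (inj₂ _) (inj₁ _) = no λ ()
  adjacent? (a ⊕ b)     (inj₂ u) (inj₂ v) = adjacent? b u v
  adjacent? (ρ _ _ _ a) u        v        = adjacent? a u v
  adjacent? (η i j _ a) u        v        =
    adjacent? a u v ⊎-dec ((clab a u Fin.≟ i ×-dec clab a v Fin.≟ j) ⊎-dec (clab a u Fin.≟ j ×-dec clab a v Fin.≟ i))

  relabel-flagged : ∀ (i j c : Fin k) b →
    relabel (flagged i true) (flagged j true) (relabel (flagged i false) (flagged j false) (flagged c b))
    ≡ flagged (relabel i j c) b
  relabel-flagged i j c b with c Fin.≟ i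
  relabel-flagged i j c false | yes refl =
    trans (cong (relabel (flagged i true) (flagged j true)) (relabel-≡ (flagged i false) (flagged j false)))
          (relabel-≢ (flagged i true) (flagged j true) (flagged j false) (flagged-≢ʳ j i false))
  relabel-flagged i j c true  | yes refl =
    trans (cong (relabel (flagged i true) (flagged j true))
                (relabel-≢ (flagged i false) (flagged j false) (flagged i true) (flagged-≢ʳ i i true)))
          (relabel-≡ (flagged i true) (flagged j true))
  relabel-flagged i j c b     | no  c≢i  =
    trans (cong (relabel (flagged i true) (flagged j true))
                (relabel-≢ (flagged i false) (flagged j false) (flagged c b) (flagged-≢ˡ b false c≢i)))
          (relabel-≢ (flagged i true) (flagged j true) (flagged c b) (flagged-≢ˡ b true c≢i))

  ρ-flagged : (i j : Fin k) → i ≢ j → CW (2 * k) → CW (2 * k)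
  ρ-flagged i j p = ρ (flagged i true) (flagged j true) (flagged-≢ˡ true true p)
                  ∘ ρ (flagged i false) (flagged j false) (flagged-≢ˡ false false p)

  η-flagged : (i j : Fin k) → i ≢ j → CW (2 * k) → CW (2 * k)
  η-flagged i j p = η (flagged i true) (flagged j true) (flagged-≢ˡ true true p)
                  ∘ η (flagged i true) (flagged j false) (flagged-≢ˡ true false p)
                  ∘ η (flagged i false) (flagged j true) (flagged-≢ˡ false true p)
                  ∘ η (flagged i false) (flagged j false) (flagged-≢ˡ false false p)

  rep-η-flagged : ∀ {a : CW (2 * k)} {ℓ : A → Fin k} {N : A → Bool} i j p →
                  Represents a R (λ u → flagged (ℓ u) (N u)) →
                  Represents (η-flagged i j p a) (λ x y → R x y ⊎ OnLabels ℓ i j x y) (λ u → flagged (ℓ u) (N u))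
  rep-η-flagged {A = A} {R = R} {ℓ = ℓ} {N} i j p r =
    along (rep-η _ _ _ (rep-η _ _ _ (rep-η _ _ _ (rep-η _ _ _ r)))) (Iso-pointwise (λ _ _ → mk⇔ to from)) (λ _ → refl)
    where
    Both : Bool → Bool → Rel A 0ℓ
    Both b b′ = OnLabels (λ u → flagged (ℓ u) (N u)) (flagged i b) (flagged j b′)
    unflag : ∀ {b b′ x y} → Both b b′ x y → OnLabels ℓ i j x y
    unflag (inj₁ (e₁ , e₂)) = inj₁ (flagged-injectiveˡ e₁ , flagged-injectiveˡ e₂)
    unflag (inj₂ (e₁ , e₂)) = inj₂ (flagged-injectiveˡ e₁ , flagged-injectiveˡ e₂)
    Four : Rel A 0ℓ
    Four x y = (((R x y ⊎ Both false false x y) ⊎ Both false true x y) ⊎ Both true false x y) ⊎ Both true true x y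
    with-flags : ∀ {x y} b b′ → Both b b′ x y → Four x y
    with-flags false false c = inj₁ (inj₁ (inj₁ (inj₂ c)))
    with-flags false true  c = inj₁ (inj₁ (inj₂ c))
    with-flags true  false c = inj₁ (inj₂ c)
    with-flags true  true  c = inj₂ c
    from : ∀ {x y} → R x y ⊎ OnLabels ℓ i j x y → Four x y
    from         (inj₁ r)                   = inj₁ (inj₁ (inj₁ (inj₁ r)))
    from {x} {y} (inj₂ (inj₁ (ℓx≡i , ℓy≡j))) =
      with-flags (N x) (N y) (inj₁ (cong (λ c → flagged c (N x)) ℓx≡i , cong (λ c → flagged c (N y)) ℓy≡j))
    from {x} {y} (inj₂ (inj₂ (ℓx≡j , ℓy≡i))) =
      with-flags (N y) (N x) (inj₂ (cong (λ c → flagged c (N x)) ℓx≡j , cong (λ c → flagged c (N y)) ℓy≡i))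
    to : ∀ {x y} → Four x y → R x y ⊎ OnLabels ℓ i j x y
    to = [ [ [ [ inj₁ , inj₂ ∘ unflag ]′ , inj₂ ∘ unflag ]′ , inj₂ ∘ unflag ]′ , inj₂ ∘ unflag ]′

  mark : (e : CW k) (N : CV e → Bool) → Σ[ e′ ∈ CW (2 * k) ] Represents e′ (CE e) (λ u → flagged (clab e u) (N u))
  mark (• i) N = • (flagged i (N tt)) , rep-• _
  mark (a ⊕ b) N with mark a (N ∘ inj₁) | mark b (N ∘ inj₂)
  ... | a′ , ra | b′ , rb = a′ ⊕ b′ , along (rep-⊕ ra rb) (Iso-pointwise (CE-⊕ a b)) [ (λ _ → refl) , (λ _ → refl) ]
  mark (ρ i j p a) N with mark a N
  ... | a′ , ra = ρ-flagged i j p a′ , relabelled (rep-ρ _ _ _ (rep-ρ _ _ _ ra))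
    (λ u → trans (relabel-flagged i j (clab a u) (N u)) (cong (λ c → flagged c (N u)) (sym (clab-ρ i j p a u))))
  mark (η i j p a) N with mark a N
  ... | a′ , ra = η-flagged i j p a′ , rep-η-flagged i j p ra

  module _ {k′ : ℕ} where
    private
      K : ℕ
      K = suc (suc k′)

    fresh spare : Fin (2 * K)
    fresh = flagged {K} zero false
    spare = flagged {K} (suc zero) false

    fresh≢spare : fresh ≢ spare
    fresh≢spare = flagged-≢ˡ false false (λ ())

    connect : List (Fin K) → CW (2 * K) → CW (2 * K)
    connect []       e = e
    connect (i ∷ is) e = η (flagged i true) fresh (flagged-≢ʳ i zero true) (connect is e)

    rep-connect : ∀ {e} {ℓ : A → Fin (2 * K)} is → Represents e R ℓ →
                  Represents (connect is e) (λ x y → R x y ⊎ Any (λ i → OnLabels ℓ (flagged i true) fresh x y) is) ℓ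
    rep-connect []       r = along r (Iso-pointwise (λ _ _ → mk⇔ inj₁ [ id , (λ ()) ]′)) (λ _ → refl)
    rep-connect (i ∷ is) r = along (rep-η _ _ _ (rep-connect is r)) (Iso-pointwise (λ _ _ → mk⇔
      [ [ inj₁ , inj₂ ∘ there ]′ , inj₂ ∘ here ]′
      [ inj₁ ∘ inj₁ , [ inj₂ , inj₁ ∘ inj₂ ]′ ∘ Any.toSum ]′)) (λ _ → refl)

    -- Flag the neighbours, move every vertex off the label fresh, and join the new vertex, labelled
    -- fresh, to all flagged labels.
    add-vertex≥2 : (e : CW K) (N : CV e → Bool) → Expressible (2 * K) (AddVertex (CE e) N)
    add-vertex≥2 e N with mark e N
    ... | e′ , r′ = connect (allFin K) (ρ fresh spare fresh≢spare e′ ⊕ • fresh) ,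
                    Iso-trans (Represents.iso (rep-connect (allFin K) (rep-⊕ (rep-ρ _ _ _ r′) (rep-• fresh))))
                              (Iso-pointwise edges)
      where
      ℓ : CV e → Fin (2 * K)
      ℓ u = relabel fresh spare (flagged (clab e u) (N u))
      ℓ≢fresh : ∀ u → ℓ u ≢ fresh
      ℓ≢fresh u = relabel-≢-source (flagged (clab e u) (N u)) (fresh≢spare ∘ sym)
      marked : ∀ {u i} → ℓ u ≡ flagged i true → T (N u)
      marked {u} {i} ℓu≡ = Equivalence.from T-≡ (begin
        N u                                ≡⟨ flag-flagged (clab e u) (N u) ⟨
        flag (flagged (clab e u) (N u))    ≡⟨ flag-relabel _ (trans (flag-flagged _ _) (sym (flag-flagged _ _))) ⟨
        flag {K} (ℓ u)                     ≡⟨ cong (flag {K}) ℓu≡ ⟩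
        flag (flagged i true)              ≡⟨ flag-flagged i true ⟩
        true                               ∎)
        where open ≡-Reasoning
      unmoved : ∀ u → T (N u) → ℓ u ≡ flagged (clab e u) true
      unmoved u t rewrite Equivalence.to T-≡ t = relabel-≢ fresh spare _ (flagged-≢ʳ (clab e u) zero true)
      fresh≢marked : ∀ i → fresh ≢ flagged i true
      fresh≢marked i = flagged-≢ʳ zero i false
      attached : ∀ x y → (∃ λ i → OnLabels [ ℓ , const fresh ]′ (flagged i true) fresh x y) ⇔
                         AddVertex (λ _ _ → ⊥) N x y
      attached (inj₁ u) (inj₁ v) =
        mk⇔ (λ { (_ , inj₁ (_ , ℓv≡)) → ℓ≢fresh v ℓv≡ ; (_ , inj₂ (ℓu≡ , _)) → ℓ≢fresh u ℓu≡ }) ⊥-elim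
      attached (inj₁ u) (inj₂ _) =
        mk⇔ (λ { (_ , inj₁ (ℓu≡ , _)) → marked ℓu≡ ; (_ , inj₂ (ℓu≡ , _)) → ⊥-elim (ℓ≢fresh u ℓu≡) })
            (λ t → clab e u , inj₁ (unmoved u t , refl))
      attached (inj₂ _) (inj₁ v) =
        mk⇔ (λ { (i , inj₁ (z≡ , _)) → ⊥-elim (fresh≢marked i z≡) ; (_ , inj₂ (_ , ℓv≡)) → marked ℓv≡ })
            (λ t → clab e v , inj₂ (refl , unmoved v t))
      attached (inj₂ _) (inj₂ _) =
        mk⇔ (λ { (i , inj₁ (z≡ , _)) → fresh≢marked i z≡ ; (i , inj₂ (_ , z≡)) → fresh≢marked i z≡ }) ⊥-elim
      edges : ∀ x y → ((CE e ⊎ᴿ (λ _ _ → ⊥)) x y ⊎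
                       Any (λ i → OnLabels [ ℓ , const fresh ]′ (flagged i true) fresh x y) (allFin K))
                      ⇔ AddVertex (CE e) N x y
      edges x y = ⇔-trans (⇔-refl ⊎-⇔ ⇔-trans Any-allFin⇔∃ (attached x y)) (AddVertex-⊎ x y)

  edgeless₁ : (e : CW 1) → ∀ u v → ¬ CE e u v
  edgeless₁ (a ⊕ b)             (inj₁ u) (inj₁ v) = edgeless₁ a u v
  edgeless₁ (a ⊕ b)             (inj₂ u) (inj₂ v) = edgeless₁ b u v
  edgeless₁ (ρ zero zero 0≢0 _) _        _        = λ _ → 0≢0 refl
  edgeless₁ (η zero zero 0≢0 _) _        _        = λ _ → 0≢0 refl

  -- With one label the graph is edgeless; the neighbours of the new vertex are kept from the first
  -- copy of e, all other vertices from the second.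
  add-vertex₁ : (e : CW 1) (N : CV e → Bool) → Expressible 2 (AddVertex (CE e) N)
  add-vertex₁ e N = [ (λ none → ⊥-elim (none (Iso.from I z) (subst (T ∘ Choose N) (sym (Iso.to∘from I z)) tt)))
                    , (λ (f , rf) → f , Iso-trans (Represents.iso rf)
                                         (Iso-trans (Iso-restrict I (Choose N)) (mkIso (choose-↔ N) edges))) ]′
                    (restrict two-copies (Choose N ∘ Iso.to I))
    where
    two-copies : CW 2
    two-copies = η zero (suc zero) (λ ()) (• zero ⊕ flat (suc zero) e) ⊕ flat (suc zero) e
    Star : Rel ((⊤ ⊎ CV e) ⊎ CV e) 0ℓ
    Star = (λ x y → ((λ _ _ → ⊥) ⊎ᴿ (λ _ _ → ⊥)) x y
                    ⊎ OnLabels [ const zero , const (suc zero) ]′ zero (suc zero) x y)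
           ⊎ᴿ (λ _ _ → ⊥)
    I : Iso (CE two-copies) Star
    I = Represents.iso (rep-⊕ (rep-η _ _ _ (rep-⊕ (rep-• zero) (rep-flat (suc zero) e))) (rep-flat (suc zero) e))
    z : (⊤ ⊎ CV e) ⊎ CV e
    z = inj₁ (inj₁ tt)
    none-of : ∀ {u v} → CE e u v ⇔ ⊥
    none-of = mk⇔ (edgeless₁ e _ _) ⊥-elim
    edges : ∀ p p′ → (Star on proj₁) p p′ ⇔
                     AddVertex (CE e) N (Inverse.to (choose-↔ N) p) (Inverse.to (choose-↔ N) p′)
    edges (inj₁ (inj₁ _) , _) (inj₁ (inj₁ _) , _)  =
      mk⇔ (λ { (inj₁ ()) ; (inj₂ (inj₁ (_ , ()))) ; (inj₂ (inj₂ (() , _))) }) ⊥-elim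
    edges (inj₁ (inj₁ _) , _) (inj₁ (inj₂ _) , t)  = mk⇔ (const t) (const (inj₂ (inj₁ (refl , refl))))
    edges (inj₁ (inj₁ _) , _) (inj₂ _ , t)         = mk⇔ ⊥-elim (λ t′ → not-both t′ t)
    edges (inj₁ (inj₂ _) , t) (inj₁ (inj₁ _) , _)  = mk⇔ (const t) (const (inj₂ (inj₂ (refl , refl))))
    edges (inj₁ (inj₂ _) , _) (inj₁ (inj₂ _) , _)  =
      ⇔-trans (mk⇔ (λ { (inj₁ ()) ; (inj₂ (inj₁ (() , _))) ; (inj₂ (inj₂ (_ , ()))) }) ⊥-elim) (⇔-sym none-of)
    edges (inj₁ (inj₂ _) , _) (inj₂ _ , _)         = ⇔-sym none-of
    edges (inj₂ _ , t)        (inj₁ (inj₁ _) , _)  = mk⇔ ⊥-elim (λ t′ → not-both t′ t)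
    edges (inj₂ _ , _)        (inj₁ (inj₂ _) , _)  = ⇔-sym none-of
    edges (inj₂ _ , _)        (inj₂ _ , _)         = ⇔-sym none-of

  add-vertex : (e : CW k) (N : CV e → Bool) → Expressible (2 * k) (AddVertex (CE e) N)
  add-vertex {zero}          e = ⊥-elim (no-expr₀ e)
  add-vertex {suc zero}      e = add-vertex₁ e
  add-vertex {suc (suc _)}   e = add-vertex≥2 e

cw-axioms : WidthAxioms cw-expressions
cw-axioms = record
  { no-expr₀   = no-expr₀
  ; vertex     = vertex
  ; point      = λ i → • i , Represents.iso (rep-• i)
  ; vertex-≟   = vertex-≟
  ; adjacent?  = adjacent?
  ; restrict   = λ e P → Sum.map₂ (λ (e′ , r) → e′ , Represents.iso r) (restrict e P)
  ; substitute = λ e σ → substitute e σ , Represents.iso (rep-substitute e σ)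
  ; add-vertex = add-vertex
  }
  where open CliqueWidth
        open Expressions cw-expressions using (module Represents)

-- NLC-width

JoinR : (Fin k → Fin k → Bool) → Rel A 0ℓ → Rel B 0ℓ → (A → Fin k) → (B → Fin k) → Rel (A ⊎ B) 0ℓ
JoinR S R R′ ℓ ℓ′ (inj₁ a) (inj₁ a′) = R a a′
JoinR S R R′ ℓ ℓ′ (inj₂ b) (inj₂ b′) = R′ b b′
JoinR S R R′ ℓ ℓ′ (inj₁ a) (inj₂ b)  = T (S (ℓ a) (ℓ′ b))
JoinR S R R′ ℓ ℓ′ (inj₂ b) (inj₁ a)  = T (S (ℓ a) (ℓ′ b))

nlc-expressions : Expressions
nlc-expressions = record { Expr = NLC ; Vtx = NV ; Adj = NE ; lab = nlab }

module NLCWidth where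
  open Expressions nlc-expressions using (Expressible; Represents; represents; along; relabelled; module Represents)

  rep-• : (i : Fin k) → Represents (• i) {A = ⊤} (λ _ _ → ⊥) (const i)
  rep-• i = represents (Iso-pointwise (λ _ _ → ⇔-refl)) (λ _ → refl)

  rep-join : ∀ {a b : NLC k} {ℓ ℓ′} S → Represents a R ℓ → Represents b S′ ℓ′ →
             Represents (join S a b) (JoinR S R S′ ℓ ℓ′) [ ℓ , ℓ′ ]′
  rep-join {R = R} {S′ = S′} {a = a} {b} {ℓ} {ℓ′} S (represents I L) (represents J M) =
    represents (mkIso (Iso⇒↔ I ⊎-↔ Iso⇒↔ J) edges) [ L , M ]
    where
    edges : ∀ x y → NE (join S a b) x y ⇔
                    JoinR S R S′ ℓ ℓ′ (Sum.map (Iso.to I) (Iso.to J) x) (Sum.map (Iso.to I) (Iso.to J) y)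
    edges (inj₁ u) (inj₁ v) = Iso.edges I u v
    edges (inj₁ u) (inj₂ v) = ≡⇒⇔₂ (λ c d → T (S c d)) (L u) (M v)
    edges (inj₂ v) (inj₁ u) = ≡⇒⇔₂ (λ c d → T (S c d)) (L u) (M v)
    edges (inj₂ u) (inj₂ v) = Iso.edges J u v

  rep-∘R : ∀ {a : NLC k} {ℓ} f → Represents a R ℓ → Represents (∘R f a) R (f ∘ ℓ)
  rep-∘R f (represents I L) = represents I (cong f ∘ L)

  flat : Fin k → NLC k₀ → NLC k
  flat i (• _)        = • i
  flat i (join _ a b) = join (λ _ _ → false) (flat i a) (flat i b)
  flat i (∘R _ a)     = flat i a

  rep-flat : (i : Fin k) (f : NLC k₀) → Represents (flat i f) {A = NV f} (λ _ _ → ⊥) (const i)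
  rep-flat i (• _)        = rep-• i
  rep-flat i (join _ a b) =
    along (rep-join _ (rep-flat i a) (rep-flat i b)) (Iso-pointwise edges) [ (λ _ → refl) , (λ _ → refl) ]
    where
    edges : ∀ x y → JoinR (λ _ _ → false) (λ _ _ → ⊥) (λ _ _ → ⊥) (const i) (const i) x y ⇔ ⊥
    edges (inj₁ _) (inj₁ _) = ⇔-refl
    edges (inj₁ _) (inj₂ _) = ⇔-refl
    edges (inj₂ _) (inj₁ _) = ⇔-refl
    edges (inj₂ _) (inj₂ _) = ⇔-refl
  rep-flat i (∘R _ a)     = rep-flat i a

  NE-join-Σ : ∀ S (a b : NLC k) {F : NV a ⊎ NV b → Set} x y →
              JoinR S (NE a on proj₁) (NE b on proj₁) (nlab a ∘ proj₁) (nlab b ∘ proj₁) x y ⇔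
              (NE (join S a b) on proj₁) (Inverse.to (Σ-⊎-↔ {F = F}) x) (Inverse.to Σ-⊎-↔ y)
  NE-join-Σ S a b (inj₁ _) (inj₁ _) = ⇔-refl
  NE-join-Σ S a b (inj₁ _) (inj₂ _) = ⇔-refl
  NE-join-Σ S a b (inj₂ _) (inj₁ _) = ⇔-refl
  NE-join-Σ S a b (inj₂ _) (inj₂ _) = ⇔-refl

  restrict : (e : NLC k) (P : NV e → Bool) →
             Empty (T ∘ P) ⊎ Σ[ e′ ∈ NLC k ] Represents e′ {A = Σ (NV e) (T ∘ P)} (NE e on proj₁) (nlab e ∘ proj₁)
  restrict (• i) P with T? (P tt)
  ... | yes t  = inj₂ (• i , along (rep-• i) (mkIso (⊤↔Σ t) (λ _ _ → ⇔-refl)) (λ _ → refl))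
  ... | no  ¬t = inj₁ (λ _ → ¬t)
  restrict (join S a b) P with restrict a (P ∘ inj₁) | restrict b (P ∘ inj₂)
  ... | inj₁ none₁     | inj₁ none₂     = inj₁ [ none₁ , none₂ ]
  ... | inj₂ (a′ , ra) | inj₁ none₂     = inj₂ (a′ , along ra (mkIso (Σ-⊎-inj₁ none₂) (λ _ _ → ⇔-refl)) (λ _ → refl))
  ... | inj₁ none₁     | inj₂ (b′ , rb) = inj₂ (b′ , along rb (mkIso (Σ-⊎-inj₂ none₁) (λ _ _ → ⇔-refl)) (λ _ → refl))
  ... | inj₂ (a′ , ra) | inj₂ (b′ , rb) =
    inj₂ (join S a′ b′ , along (rep-join S ra rb) (mkIso Σ-⊎-↔ (NE-join-Σ S a b)) [ (λ _ → refl) , (λ _ → refl) ])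
  restrict (∘R f a) P = Sum.map₂ (λ (a′ , ra) → ∘R f a′ , rep-∘R f ra) (restrict a P)

  substitute : (e : NLC k) → (NV e → NLC k₀) → NLC k
  substitute (• i)        σ = flat i (σ tt)
  substitute (join S a b) σ = join S (substitute a (σ ∘ inj₁)) (substitute b (σ ∘ inj₂))
  substitute (∘R f a)     σ = ∘R f (substitute a σ)

  rep-substitute : (e : NLC k) (σ : NV e → NLC k₀) →
                   Represents (substitute e σ) {A = Σ (NV e) (NV ∘ σ)} (NE e on proj₁) (nlab e ∘ proj₁)
  rep-substitute (• i)        σ = along (rep-flat i (σ tt)) (mkIso ⊤-Σ-↔ (λ _ _ → ⇔-refl)) (λ _ → refl)
  rep-substitute (join S a b) σ =
    along (rep-join S (rep-substitute a (σ ∘ inj₁)) (rep-substitute b (σ ∘ inj₂))) (mkIso Σ-⊎-↔ (NE-join-Σ S a b))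
          [ (λ _ → refl) , (λ _ → refl) ]
  rep-substitute (∘R f a)     σ = rep-∘R f (rep-substitute a σ)

  no-expr₀ : NLC 0 → ⊥
  no-expr₀ (• ())
  no-expr₀ (join _ a _) = no-expr₀ a
  no-expr₀ (∘R _ a)     = no-expr₀ a

  vertex : (e : NLC k) → NV e
  vertex (• _)        = tt
  vertex (join _ a _) = inj₁ (vertex a)
  vertex (∘R _ a)     = vertex a

  vertex-≟ : (e : NLC k) → DecidableEquality (NV e)
  vertex-≟ (• _)        = ⊤-≟
  vertex-≟ (join _ a b) = ⊎-≟ (vertex-≟ a) (vertex-≟ b)
  vertex-≟ (∘R _ a)     = vertex-≟ a

  adjacent? : (e : NLC k) → Decidable (NE e)
  adjacent? (• _)        _        _        = no λ ()
  adjacent? (join S a b) (inj₁ u) (inj₁ v) = adjacent? a u v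
  adjacent? (join S a b) (inj₁ u) (inj₂ v) = T? (S (nlab a u) (nlab b v))
  adjacent? (join S a b) (inj₂ v) (inj₁ u) = T? (S (nlab a u) (nlab b v))
  adjacent? (join S a b) (inj₂ u) (inj₂ v) = adjacent? b u v
  adjacent? (∘R _ a)     u        v        = adjacent? a u v

  mark : (e : NLC k) (N : NV e → Bool) → Σ[ e′ ∈ NLC (2 * k) ] Represents e′ (NE e) (λ u → flagged (nlab e u) (N u))
  mark (• i) N = • (flagged i (N tt)) , rep-• _
  mark {k} (join S a b) N with mark a (N ∘ inj₁) | mark b (N ∘ inj₂)
  ... | a′ , ra | b′ , rb = join (λ c d → S (base {k} c) (base d)) a′ b′ ,
                            along (rep-join _ ra rb) (Iso-pointwise edges) [ (λ _ → refl) , (λ _ → refl) ]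
    where
    edges : ∀ x y → JoinR (λ c d → S (base {k} c) (base d)) (NE a) (NE b) (λ u → flagged (nlab a u) (N (inj₁ u)))
                          (λ v → flagged (nlab b v) (N (inj₂ v))) x y ⇔ NE (join S a b) x y
    edges (inj₁ _) (inj₁ _) = ⇔-refl
    edges (inj₁ u) (inj₂ v) = ≡⇒⇔₂ (λ c d → T (S c d)) (base-flagged _ _) (base-flagged _ _)
    edges (inj₂ v) (inj₁ u) = ≡⇒⇔₂ (λ c d → T (S c d)) (base-flagged _ _) (base-flagged _ _)
    edges (inj₂ _) (inj₂ _) = ⇔-refl
  mark {k} (∘R f a) N with mark a N
  ... | a′ , ra = ∘R (λ c → flagged (f (base {k} c)) (flag {k} c)) a′ ,
                  relabelled (rep-∘R _ ra) (λ u → cong₂ flagged (cong f (base-flagged _ _)) (flag-flagged _ _))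

  add-vertex : (e : NLC k) (N : NV e → Bool) → Expressible (2 * k) (AddVertex (NE e) N)
  add-vertex {zero}  e N = ⊥-elim (no-expr₀ e)
  add-vertex {suc k} e N with mark e N
  ... | e′ , r′ =
    join (λ c _ → flag {suc k} c) e′ (• (flagged zero false)) ,
    Iso-trans (Represents.iso (rep-join _ r′ (rep-• _))) (Iso-pointwise edges)
    where
    edges : ∀ x y → JoinR (λ c _ → flag {suc k} c) (NE e) (λ _ _ → ⊥)
                          (λ u → flagged (nlab e u) (N u)) (const (flagged zero false)) x y ⇔
                    AddVertex (NE e) N x y
    edges (inj₁ _) (inj₁ _) = ⇔-refl
    edges (inj₁ u) (inj₂ _) = ≡⇒⇔ T (flag-flagged (nlab e u) (N u))
    edges (inj₂ _) (inj₁ u) = ≡⇒⇔ T (flag-flagged (nlab e u) (N u))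
    edges (inj₂ _) (inj₂ _) = ⇔-refl

nlc-axioms : WidthAxioms nlc-expressions
nlc-axioms = record
  { no-expr₀   = no-expr₀
  ; vertex     = vertex
  ; point      = λ i → • i , Represents.iso (rep-• i)
  ; vertex-≟   = vertex-≟
  ; adjacent?  = adjacent?
  ; restrict   = λ e P → Sum.map₂ (λ (e′ , r) → e′ , Represents.iso r) (restrict e P)
  ; substitute = λ e σ → substitute e σ , Represents.iso (rep-substitute e σ)
  ; add-vertex = add-vertex
  }
  where open NLCWidth
        open Expressions nlc-expressions using (module Represents)

theorem10 : (G : Graph) → Finite G → (x y : V G) → x ≢ y →
    (∀ a b → IsNLCW G a → IsNLCW (identify G x y) b → a ≤ 4 * b × b ≤ 2 * a) ×
    (∀ a b → IsCW G a → IsCW (identify G x y) b → a ≤ 4 * b × b ≤ 2 * a)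
theorem10 G (_ , V↔Fin) x y x≢y = width-bounds nlc-axioms G x y x≢y _≟_ , width-bounds cw-axioms G x y x≢y _≟_
  where
  _≟_ : DecidableEquality (V G)
  _≟_ = Dec.via-injection (↔⇒↣ V↔Fin) Fin._≟_
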